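{- Let $a,b\in\mathbb{Z}$ with $a>0$. Then the equation $x^2-ay^2-bz^2=1$ has at least one solution $(x,y,z)\in\mathbb{Z}^3$ with $xz\ne0$. -}

module Defs where

module Submission where

-- Choose m ≠ 0 making D = am² + b a positive integer.  By Pell's theorem either
-- √D = p/q is rational or X² − DY² = 1 has a solution with Y ≠ 0.  In the Pell
-- case (X, mY, Y) solves the equation, as X² − a(mY)² − bY² = X² − DY².  In the
-- rational case (mq : q : ±p) is a point of the conic am² + bn² = s², and an
-- explicit polynomial identity turns such a point into a solution.
--
-- Dirichlet's
-- pigeonhole argument gives, for every N, an approximation p/q of √D with
-- |p² − Dq²| ≤ 2p/N (DirichletApproximation, on top of SquareRoots).  Unless
-- one of them is exact this yields arbitrarily many pairs with distinct
-- numerators and 0 < |p² − Dq²| ≤ 2D; two of them share their norm and their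
-- residues modulo (2D)!, and composing them (Composition) gives a nontrivial
-- solution (PellEquation).

-- Squares and integer square roots of natural numbers.  An inequality
-- u ≤ v√C between reals is expressed throughout as  u * u ≤ C * (v * v).
module SquareRoots where
  open import Data.Nat
  open import Data.Nat.Properties
  open import Data.Nat.Tactic.RingSolver using (solve-∀)
  open import Data.Product using (Σ-syntax; _×_; _,_; proj₁; proj₂)
  open import Relation.Binary.PropositionalEquality
  open import Relation.Nullary using (yes; no; contradiction)

  square-mono-≤ : ∀ {u v} → u ≤ v → u * u ≤ v * v
  square-mono-≤ u≤v = *-mono-≤ u≤v u≤v

  square-mono-< : ∀ {u v} → u < v → u * u < v * v
  square-mono-< u<v = *-mono-< u<v u<v

  square-cancel-≤ : ∀ {u v} → u * u ≤ v * v → u ≤ v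
  square-cancel-≤ {u} {v} uu≤vv with u ≤? v
  ... | yes u≤v = u≤v
  ... | no  u≰v = contradiction uu≤vv (<⇒≱ (square-mono-< (≰⇒> u≰v)))

  square-cancel-< : ∀ {u v} → u * u < v * v → u < v
  square-cancel-< {u} {v} uu<vv with u <? v
  ... | yes u<v = u<v
  ... | no  u≮v = contradiction (square-mono-≤ (≮⇒≥ u≮v)) (<⇒≱ uu<vv)

  abstract
    isqrt : (X : ℕ) → Σ[ r ∈ ℕ ] r * r ≤ X × X < suc r * suc r
    isqrt zero = 0 , z≤n , s≤s z≤n
    isqrt (suc X) with isqrt X
    ... | r , lower , upper with suc r * suc r ≤? suc X
    ...   | yes next≤ = suc r , next≤ , ≤-<-trans upper (square-mono-< (n<1+n (suc r)))
    ...   | no  next≰ = r , ≤-trans lower (n≤1+n X) , ≰⇒> next≰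

    ⌊√_⌋ : ℕ → ℕ
    ⌊√ X ⌋ = proj₁ (isqrt X)

    √-lower : ∀ X → ⌊√ X ⌋ * ⌊√ X ⌋ ≤ X
    √-lower X = proj₁ (proj₂ (isqrt X))

    √-upper : ∀ X → X < suc ⌊√ X ⌋ * suc ⌊√ X ⌋
    √-upper X = proj₂ (proj₂ (isqrt X))

  √-greatest : ∀ {u X} → u * u ≤ X → u ≤ ⌊√ X ⌋
  √-greatest {u} {X} uu≤X = s≤s⁻¹ (square-cancel-< (≤-<-trans uu≤X (√-upper X)))

  √-below : ∀ {v X} → X < v * v → ⌊√ X ⌋ < v
  √-below {v} {X} X<vv = square-cancel-< (≤-<-trans (√-lower X) X<vv)

  private
    square-sum : ∀ u w → (u + w) * (u + w) ≡ u * u + 2 * (u * w) + w * w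
    square-sum = solve-∀
    scaled-square-sum : ∀ C v z → C * ((v + z) * (v + z)) ≡ C * (v * v) + 2 * (C * v * z) + C * (z * z)
    scaled-square-sum = solve-∀
    square-product : ∀ u w → (u * w) * (u * w) ≡ (u * u) * (w * w)
    square-product = solve-∀
    scaled-square-product : ∀ C v z → (C * (v * v)) * (C * (z * z)) ≡ (C * v * z) * (C * v * z)
    scaled-square-product = solve-∀

  -- Square-root inequalities can be added:  u ≤ v√C  and  w ≤ z√C  give
  -- u + w ≤ (v + z)√C; the cross terms compare since uw ≤ vz·C.
  root-add-≤ : ∀ {C u v w z} → u * u ≤ C * (v * v) → w * w ≤ C * (z * z) →
               (u + w) * (u + w) ≤ C * ((v + z) * (v + z))
  root-add-≤ {C} {u} {v} {w} {z} uv wz =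
    subst₂ _≤_ (sym (square-sum u w)) (sym (scaled-square-sum C v z))
      (+-mono-≤ (+-mono-≤ uv (*-monoʳ-≤ 2 cross)) wz)
    where
    cross : u * w ≤ C * v * z
    cross = square-cancel-≤ (subst₂ _≤_ (sym (square-product u w)) (scaled-square-product C v z)
              (*-mono-≤ uv wz))

  root-add-< : ∀ {C u v w z} → C * (v * v) ≤ u * u → C * (z * z) < w * w →
               C * ((v + z) * (v + z)) < (u + w) * (u + w)
  root-add-< {C} {u} {v} {w} {z} vu zw =
    subst₂ _<_ (sym (scaled-square-sum C v z)) (sym (square-sum u w))
      (+-mono-≤-< (+-mono-≤ vu (*-monoʳ-≤ 2 cross)) zw)
    where
    cross : C * v * z ≤ u * w
    cross = square-cancel-≤ (subst₂ _≤_ (scaled-square-product C v z) (sym (square-product u w))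
              (*-mono-≤ vu (<⇒≤ zw)))

module DirichletApproximation where
  open import Data.Nat
  open import Data.Nat.Properties
  open import Data.Nat.Tactic.RingSolver using (solve-∀)
  open import Data.Fin using (toℕ; fromℕ<)
  open import Data.Fin.Properties using (pigeonhole; fromℕ<-injective; toℕ<n)
  open import Data.Product using (_×_; _,_)
  open import Relation.Binary.PropositionalEquality
  open import Relation.Nullary using (yes; no; contradiction)
  open SquareRoots

  -- Close D N p q says |p² − Dq²| ≤ 2p/N: the fraction p/q is within about
  -- 1/(Nq) of √D.  Both one-sided truncated differences are bounded.
  Close : ℕ → ℕ → ℕ → ℕ → Set
  Close D N p q = N * (D * (q * q) ∸ p * p) ≤ 2 * p × N * (p * p ∸ D * (q * q)) ≤ 2 * p

  private
    scaled-monus : ∀ N X Y → N * (N * (X ∸ Y)) ≡ N * N * X ∸ N * N * Y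
    scaled-monus N X Y = begin
      N * (N * (X ∸ Y))       ≡⟨ cong (N *_) (*-distribˡ-∸ N X Y) ⟩
      N * (N * X ∸ N * Y)     ≡⟨ *-distribˡ-∸ N (N * X) (N * Y) ⟩
      N * (N * X) ∸ N * (N * Y) ≡⟨ cong₂ _∸_ (sym (*-assoc N N X)) (sym (*-assoc N N Y)) ⟩
      N * N * X ∸ N * N * Y   ∎
      where open ≡-Reasoning

    scaled-gap : ∀ N .{{_ : NonZero N}} X Y p → N * N * X ≤ N * N * Y + N * (2 * p) →
                 N * (X ∸ Y) ≤ 2 * p
    scaled-gap N X Y p le = *-cancelˡ-≤ N (subst (_≤ N * (2 * p)) (sym (scaled-monus N X Y))
                              (m≤n+o⇒m∸n≤o (N * N * X) (N * N * Y) le))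

    square-succ : ∀ r → suc r * suc r ≡ suc (r * r + 2 * r)
    square-succ = solve-∀
    scale-rhs : ∀ N p → (N * p) * (N * p) + 2 * (N * p) ≡ N * N * (p * p) + N * (2 * p)
    scale-rhs = solve-∀
    scale-lhs : ∀ N D q → N * N * D * (q * q) ≡ N * N * (D * (q * q))
    scale-lhs = solve-∀

    scale-square : ∀ N p → (N * p) * (N * p) ≡ N * N * (p * p)
    scale-square = solve-∀
    swap-scale : ∀ a N p → a * (N * p) ≡ N * (a * p)
    swap-scale = solve-∀
    square-swap : ∀ D q → D * (D * (q * q)) ≡ (q * D) * (q * D)
    square-swap = solve-∀
    swap-last : ∀ x y z → x + y + z ≡ x + z + y
    swap-last = solve-∀

    square-below : ∀ X r → (∀ P' → r ≡ suc P' → P' * P' < X) → r * r ≤ X + 2 * r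
    square-below X zero    _     = z≤n
    square-below X (suc P) below = begin
      suc P * suc P       ≡⟨ square-succ P ⟩
      suc (P * P) + 2 * P ≤⟨ +-mono-≤ (below P refl) (*-monoʳ-≤ 2 (n≤1+n P)) ⟩
      X + 2 * suc P       ∎
      where open ≤-Reasoning

  -- With c = N²D and r = Np, the bracket  r − 1 < q√c < r + 1  gives Close D N p q.
  bracket⇒close : ∀ D N .{{_ : NonZero N}} p q →
    N * N * D * (q * q) < suc (N * p) * suc (N * p) →
    (∀ P' → N * p ≡ suc P' → P' * P' < N * N * D * (q * q)) → Close D N p q
  bracket⇒close D N p q upper lower = scaled-gap N _ _ p upper' , scaled-gap N _ _ p lower'
    where
    X = N * N * D * (q * q)
    upper' : N * N * (D * (q * q)) ≤ N * N * (p * p) + N * (2 * p)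
    upper' = subst₂ _≤_ (scale-lhs N D q) (scale-rhs N p)
               (s≤s⁻¹ (subst (X <_) (square-succ (N * p)) upper))
    lower' : N * N * (p * p) ≤ N * N * (D * (q * q)) + N * (2 * p)
    lower' = subst₂ _≤_ (scale-square N p) (cong₂ _+_ (scale-lhs N D q) (swap-scale 2 N p))
               (square-below X (N * p) lower)

  record Approximation (D N : ℕ) : Set where
    constructor approximation
    field
      p q   : ℕ
      1≤q   : 1 ≤ q
      p≤N*D : p ≤ N * D
      close : Close D N p q

  module _ (D N : ℕ) .{{_ : NonZero D}} .{{_ : NonZero N}} where
    private
      c : ℕ
      c = N * N * D

      abstract
        B A : ℕ → ℕ
        B q = ⌊√ (D * (q * q)) ⌋
        A q = ⌊√ (c * (q * q)) ⌋

        NB≤A : ∀ q → N * B q ≤ A q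
        NB≤A q = √-greatest (subst₂ _≤_ (sym (scale-square N (B q))) (sym (scale-lhs N D q))
                   (*-monoʳ-≤ (N * N) (√-lower (D * (q * q)))))

        A<NB+N : ∀ q → A q < N * B q + N
        A<NB+N q = subst (A q <_) (trans (*-suc N (B q)) (+-comm N (N * B q)))
                     (√-below (subst₂ _<_ (sym (scale-lhs N D q)) (sym (scale-square N (suc (B q))))
                       (*-monoʳ-< (N * N) {{m*n≢0 N N}} (√-upper (D * (q * q))))))

        -- the fractional part of q√D, in units of 1/N
        frac : ℕ → ℕ
        frac q = A q ∸ N * B q

        frac<N : ∀ q → frac q < N
        frac<N q = m<n+o⇒m∸n<o (A q) (N * B q) (A<NB+N q)

        A-split : ∀ q → A q ≡ N * B q + frac q
        A-split q = sym (m+[n∸m]≡n (NB≤A q))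

        A-lower : ∀ q → A q * A q ≤ c * (q * q)
        A-lower q = √-lower (c * (q * q))

        A-upper : ∀ q → c * (q * q) < suc (A q) * suc (A q)
        A-upper q = √-upper (c * (q * q))

        B-mono : ∀ {q q'} → q ≤ q' → B q ≤ B q'
        B-mono q≤q' = √-greatest (≤-trans (√-lower _) (*-monoʳ-≤ D (square-mono-≤ q≤q')))

        B-bound : ∀ q → B q ≤ q * D
        B-bound q = square-cancel-≤ (≤-trans (√-lower (D * (q * q)))
                      (≤-trans (m≤n*m (D * (q * q)) D) (≤-reflexive (square-swap D q))))

    private
      -- If ⌊N(q₁ + q)√D⌋ = ⌊Nq₁√D⌋ + r then q√c < r + 1: otherwise
      -- ⌊Nq₁√D⌋ + r + 1 ≤ N(q₁ + q)√D would exceed ⌊N(q₁ + q)√D⌋.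
      bracket-upper : ∀ q₁ q r → A q₁ + r ≡ A (q₁ + q) → c * (q * q) < suc r * suc r
      bracket-upper q₁ q r step with c * (q * q) <? suc r * suc r
      ... | yes lt = lt
      ... | no  ge = contradiction (subst (_≤ c * ((q₁ + q) * (q₁ + q))) sum-eq
                       (root-add-≤ {c} {A q₁} {q₁} {suc r} {q} (A-lower q₁) (≮⇒≥ ge)))
                       (<⇒≱ (A-upper (q₁ + q)))
        where
        sum-eq : (A q₁ + suc r) * (A q₁ + suc r) ≡ suc (A (q₁ + q)) * suc (A (q₁ + q))
        sum-eq = cong (λ x → x * x) (trans (+-suc (A q₁) r) (cong suc step))

      -- ... and r − 1 < q√c: otherwise N(q₁ + q)√D < (r − 1) + ⌊Nq₁√D⌋ + 1.
      bracket-lower : ∀ q₁ q r → A q₁ + r ≡ A (q₁ + q) →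
                      ∀ P' → r ≡ suc P' → P' * P' < c * (q * q)
      bracket-lower q₁ q r step P' r≡ with P' * P' <? c * (q * q)
      ... | yes lt = lt
      ... | no  ge = contradiction (A-lower (q₁ + q))
                       (<⇒≱ (subst₂ _<_ (cong (λ x → c * (x * x)) (+-comm q q₁)) sum-eq
                         (root-add-< {c} {P'} {q} {suc (A q₁)} {q₁} (≮⇒≥ ge) (A-upper q₁))))
        where
        sum-eq : (P' + suc (A q₁)) * (P' + suc (A q₁)) ≡ A (q₁ + q) * A (q₁ + q)
        sum-eq = cong (λ x → x * x) (trans (+-suc P' (A q₁))
                   (trans (cong (_+ A q₁) (sym r≡)) (trans (+-comm r (A q₁)) step)))

    -- Two denominators 0 ≤ q₁ < q₂ ≤ N with equal fractional parts at
    -- resolution 1/N exist by pigeonhole; then ⌊Nq₂√D⌋ = ⌊Nq₁√D⌋ + Np for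
    -- p/q = (⌊q₂√D⌋ − ⌊q₁√D⌋)/(q₂ − q₁), which therefore approximates √D.
    dirichlet : Approximation D N
    dirichlet with pigeonhole (n<1+n N) (λ i → fromℕ< (frac<N (toℕ i)))
    ... | i , j , i<j , same = approximation p q (m<n⇒0<n∸m q₁<q₂) p≤N*D
                                 (bracket⇒close D N p q (bracket-upper q₁ q (N * p) step)
                                                        (bracket-lower q₁ q (N * p) step))
      where
      q₁ q₂ p q : ℕ
      q₁ = toℕ i
      q₂ = toℕ j
      p = B q₂ ∸ B q₁
      q = q₂ ∸ q₁
      q₁<q₂ : q₁ < q₂
      q₁<q₂ = i<j
      p≤N*D : p ≤ N * D
      p≤N*D = ≤-trans (m∸n≤m (B q₂) (B q₁)) (≤-trans (B-bound q₂) (*-monoˡ-≤ D (s≤s⁻¹ (toℕ<n j))))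
      frac-eq : frac q₁ ≡ frac q₂
      frac-eq = fromℕ<-injective _ _ (frac<N q₁) (frac<N q₂) same
      step : A q₁ + N * p ≡ A (q₁ + q)
      step = begin
        A q₁ + N * p                  ≡⟨ cong (_+ N * p) (A-split q₁) ⟩
        N * B q₁ + frac q₁ + N * p    ≡⟨ swap-last (N * B q₁) (frac q₁) (N * p) ⟩
        N * B q₁ + N * p + frac q₁    ≡⟨ cong₂ _+_ (sym (*-distribˡ-+ N (B q₁) p)) frac-eq ⟩
        N * (B q₁ + p) + frac q₂      ≡⟨ cong (λ b → N * b + frac q₂) (m+[n∸m]≡n (B-mono (<⇒≤ q₁<q₂))) ⟩
        N * B q₂ + frac q₂            ≡⟨ A-split q₂ ⟨
        A q₂                          ≡⟨ cong A (m+[n∸m]≡n (<⇒≤ q₁<q₂)) ⟨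
        A (q₁ + q)                    ∎
        where open ≡-Reasoning

  abstract
    approximate : ∀ D N .{{_ : NonZero D}} .{{_ : NonZero N}} → Approximation D N
    approximate D N = dirichlet D N

module Composition where
  open import Data.Integer
  open import Data.Integer.Properties
  open import Data.Integer.Tactic.RingSolver using (solve-∀)
  open import Data.Sum using (inj₁; inj₂)
  open import Relation.Binary.PropositionalEquality

  norm : ℤ → ℤ → ℤ → ℤ
  norm D x y = x * x - D * (y * y)

  -- If P ≡ P' and Q ≡ Q' modulo kh, where k is the common norm of (P, Q) and
  -- (P', Q'), then (PP' − DQQ')/k and (PQ' − P'Q)/k are the integers below.
  composedX : ℤ → ℤ → ℤ → ℤ → ℤ → ℤ → ℤ
  composedX D h u v P' Q' = 1ℤ + h * (u * P' - D * v * Q')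

  composedY : ℤ → ℤ → ℤ → ℤ → ℤ → ℤ
  composedY h u v P' Q' = h * (u * Q' - v * P')

  private
    -- Brahmagupta's identity, specialised to congruent pairs of norm
    -- E = P'² − DQ'² (written out, as the ring solver needs).
    brahmagupta : ∀ D h u v P' Q' →
      (P' * P' - D * (Q' * Q')) * (P' * P' - D * (Q' * Q'))
        * ((1ℤ + h * (u * P' - D * v * Q')) * (1ℤ + h * (u * P' - D * v * Q'))
           - D * ((h * (u * Q' - v * P')) * (h * (u * Q' - v * P'))))
      ≡ ((P' + (P' * P' - D * (Q' * Q')) * h * u) * (P' + (P' * P' - D * (Q' * Q')) * h * u)
         - D * ((Q' + (P' * P' - D * (Q' * Q')) * h * v) * (Q' + (P' * P' - D * (Q' * Q')) * h * v)))
        * (P' * P' - D * (Q' * Q'))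
    brahmagupta = solve-∀

    square≢0 : ∀ {E} → E ≢ 0ℤ → E * E ≢ 0ℤ
    square≢0 {E} E≢0 EE≡0 with i*j≡0⇒i≡0∨j≡0 E EE≡0
    ... | inj₁ E≡0 = E≢0 E≡0
    ... | inj₂ E≡0 = E≢0 E≡0

  compose : ∀ D k h u v P Q P' Q' → k ≢ 0ℤ →
    norm D P' Q' ≡ k → norm D P Q ≡ k → P ≡ P' + k * h * u → Q ≡ Q' + k * h * v →
    norm D (composedX D h u v P' Q') (composedY h u v P' Q') ≡ 1ℤ
  compose D _ h u v _ _ P' Q' E≢0 refl norm-PQ refl refl =
    *-cancelˡ-≡ (E * E) _ 1ℤ {{≢-nonZero (square≢0 E≢0)}} (begin
      E * E * norm D X Y                              ≡⟨ brahmagupta D h u v P' Q' ⟩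
      norm D (P' + E * h * u) (Q' + E * h * v) * E    ≡⟨ cong (_* E) norm-PQ ⟩
      E * E                                           ≡⟨ *-identityʳ (E * E) ⟨
      E * E * 1ℤ                                      ∎)
    where
    open ≡-Reasoning
    E = norm D P' Q'
    X = composedX D h u v P' Q'
    Y = composedY h u v P' Q'

  composedY≡0⇒proportional : ∀ k h u v P' Q' →
    composedY h u v P' Q' ≡ 0ℤ → (P' + k * h * u) * Q' ≡ P' * (Q' + k * h * v)
  composedY≡0⇒proportional k h u v P' Q' Y≡0 = begin
    (P' + k * h * u) * Q'                                ≡⟨ expand k h u v P' Q' ⟩
    P' * (Q' + k * h * v) + k * composedY h u v P' Q'  ≡⟨ cong (λ y → P' * (Q' + k * h * v) + k * y) Y≡0 ⟩
    P' * (Q' + k * h * v) + k * 0ℤ                       ≡⟨ cong (λ y → P' * (Q' + k * h * v) + y) (*-zeroʳ k) ⟩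
    P' * (Q' + k * h * v) + 0ℤ                           ≡⟨ +-identityʳ _ ⟩
    P' * (Q' + k * h * v)                                ∎
    where
    open ≡-Reasoning
    expand : ∀ k h u v P' Q' →
      (P' + k * h * u) * Q' ≡ P' * (Q' + k * h * v) + k * (h * (u * Q' - v * P'))
    expand = solve-∀

  proportional⇒equal-squares : ∀ D k P Q P' Q' → k ≢ 0ℤ →
    norm D P Q ≡ k → norm D P' Q' ≡ k → P * Q' ≡ P' * Q → Q' * Q' ≡ Q * Q
  proportional⇒equal-squares D k P Q P' Q' k≢0 norm-PQ norm-P'Q' cross =
    *-cancelʳ-≡ _ _ k {{≢-nonZero k≢0}} (begin
      Q' * Q' * k                                   ≡⟨ cong (Q' * Q' *_) norm-PQ ⟨
      Q' * Q' * norm D P Q                          ≡⟨ scaled-norm D P Q Q' ⟩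
      (P * Q') * (P * Q') - D * (Q * Q) * (Q' * Q')  ≡⟨ cong (λ w → w * w - D * (Q * Q) * (Q' * Q')) cross ⟩
      (P' * Q) * (P' * Q) - D * (Q * Q) * (Q' * Q')  ≡⟨ scaled-norm′ D P' Q Q' ⟨
      Q * Q * norm D P' Q'                          ≡⟨ cong (Q * Q *_) norm-P'Q' ⟩
      Q * Q * k                                     ∎)
    where
    open ≡-Reasoning
    scaled-norm : ∀ D P Q Q' → Q' * Q' * (P * P - D * (Q * Q)) ≡ (P * Q') * (P * Q') - D * (Q * Q) * (Q' * Q')
    scaled-norm = solve-∀
    scaled-norm′ : ∀ D P' Q Q' → Q * Q * (P' * P' - D * (Q' * Q')) ≡ (P' * Q) * (P' * Q) - D * (Q * Q) * (Q' * Q')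
    scaled-norm′ = solve-∀

module Differences where
  open import Data.Nat as ℕ using (ℕ; zero; suc; _∸_; _%_; _/_)
  open import Data.Nat.Properties using () renaming (≤-total to ℕ-≤-total)
  open import Data.Nat.DivMod using (m≡m%n+[m/n]*n)
  open import Data.Integer hiding (_/_; _%_)
  open import Data.Integer.Properties
  open import Data.Integer.Tactic.RingSolver using (solve-∀)
  open import Data.Sum using (inj₁; inj₂)
  open import Relation.Binary.PropositionalEquality

  ⊖-truncated : ∀ m n → m ⊖ n ≡ (m ∸ n) ⊖ (n ∸ m)
  ⊖-truncated zero    zero    = refl
  ⊖-truncated zero    (suc n) = refl
  ⊖-truncated (suc m) zero    = refl
  ⊖-truncated (suc m) (suc n) = trans ([1+m]⊖[1+n]≡m⊖n m n) (⊖-truncated m n)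

  ∣⊖∣-bounded : ∀ {m n b} → m ∸ n ℕ.≤ b → n ∸ m ℕ.≤ b → ∣ m ⊖ n ∣ ℕ.≤ b
  ∣⊖∣-bounded {m} {n} m∸n≤b n∸m≤b with ℕ-≤-total m n
  ... | inj₁ m≤n = subst (ℕ._≤ _) (sym (∣⊖∣-≤ m≤n)) n∸m≤b
  ... | inj₂ n≤m = subst (ℕ._≤ _) (sym (trans (∣m⊖n∣≡∣n⊖m∣ m n) (∣⊖∣-≤ n≤m))) m∸n≤b

  residue-split : ∀ M .{{_ : ℕ.NonZero M}} m n → m % M ≡ n % M →
                  + m ≡ + n + + M * (+ (m / M) - + (n / M))
  residue-split M m n same = begin
    + m                                 ≡⟨ split m ⟩
    + (m % M) + + (m / M) * + M         ≡⟨ cong (λ r → + r + + (m / M) * + M) same ⟩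
    + (n % M) + + (m / M) * + M         ≡⟨ shift (+ (n % M)) (+ (m / M)) (+ (n / M)) (+ M) ⟩
    + (n % M) + + (n / M) * + M + + M * (+ (m / M) - + (n / M))
                                        ≡⟨ cong (_+ + M * (+ (m / M) - + (n / M))) (split n) ⟨
    + n + + M * (+ (m / M) - + (n / M)) ∎
    where
    open ≡-Reasoning
    split : ∀ m → + m ≡ + (m % M) + + (m / M) * + M
    split m = trans (cong +_ (m≡m%n+[m/n]*n m M))
                (trans (pos-+ (m % M) (m / M ℕ.* M)) (cong (λ w → + (m % M) + w) (pos-* (m / M) M)))
    shift : ∀ r a b M → r + a * M ≡ r + b * M + M * (a - b)
    shift = solve-∀

open import Data.Nat using (ℕ; NonZero; suc)

module PellEquation (D : ℕ) {{_ : NonZero D}} where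
  open import Data.Nat
  open import Data.Nat.Properties
  open import Data.Nat.Tactic.RingSolver using (solve-∀)
  open import Data.Nat.Divisibility using (_∣_; ∣-trans; m∣m*n; m≤n⇒m!∣n!)
  open import Data.Nat.DivMod using (_mod_)
  open import Data.Integer as ℤ using (ℤ; +_; _⊖_; ∣_∣; 0ℤ; 1ℤ)
  import Data.Integer.Properties as ℤ
  open import Data.Integer.Divisibility.Signed using (divides; ∣ᵤ⇒∣)
  open import Data.Fin using (Fin; zero; suc; fromℕ<; combine)
  open import Data.Fin.Properties using (pigeonhole; fromℕ<-injective; combine-injective) renaming (<⇒≢ to <⇒≢ᶠ)
  open import Data.Product using (Σ-syntax; _×_; _,_; proj₁; proj₂)
  open import Data.Sum using (_⊎_; inj₁; inj₂)
  open import Relation.Binary.PropositionalEquality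
  open import Relation.Nullary using (yes; no; contradiction)
  open DirichletApproximation
  open Composition using (norm; composedX; composedY; compose;
                          composedY≡0⇒proportional; proportional⇒equal-squares)
  open Differences
  open SquareRoots using (square-cancel-≤)

  RationalRoot : Set
  RationalRoot = Σ[ p ∈ ℕ ] Σ[ q ∈ ℕ ] 1 ≤ q × p * p ≡ D * (q * q)

  PellSolution : Set
  PellSolution = Σ[ X ∈ ℤ ] Σ[ Y ∈ ℤ ] Y ≢ 0ℤ × norm (+ D) X Y ≡ 1ℤ

  close⇒exact : ∀ {N p q} → Close D N p q → 2 * p < N → p * p ≡ D * (q * q)
  close⇒exact {N} {p} (deficit , excess) 2p<N =
    ≤-antisym (m∸n≡0⇒m≤n (small-gap excess)) (m∸n≡0⇒m≤n (small-gap deficit))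
    where
    small-gap : ∀ {g} → N * g ≤ 2 * p → g ≡ 0
    small-gap {zero}  _  = refl
    small-gap {suc g} le = contradiction (≤-trans (m≤m*n N (suc g)) le) (<⇒≱ 2p<N)

  bounded-gap : ∀ {N p g} .{{_ : NonZero N}} → N * g ≤ 2 * p → p ≤ N * D → g ≤ 2 * D
  bounded-gap {N} {p} Ng≤2p p≤ND =
    *-cancelˡ-≤ N (≤-trans Ng≤2p (≤-trans (*-monoʳ-≤ 2 p≤ND) (≤-reflexive (swap N D))))
    where
    swap : ∀ N D → 2 * (N * D) ≡ N * (2 * D)
    swap = solve-∀

  record NearPair : Set where
    constructor nearPair
    field
      num den  : ℕ
      1≤den    : 1 ≤ den
      deficit≤ : D * (den * den) ∸ num * num ≤ 2 * D
      excess≤  : num * num ∸ D * (den * den) ≤ 2 * D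
      inexact  : num * num ≢ D * (den * den)
  open NearPair

  record NearPairs (K : ℕ) : Set where
    field
      pair     : Fin K → NearPair
      scale    : ℕ
      small    : ∀ i → 2 * num (pair i) ≤ scale
      distinct : ∀ i j → num (pair i) ≡ num (pair j) → i ≡ j
  open NearPairs

  -- Dirichlet at resolution N > scale yields an exact root or a near pair whose
  -- numerator is new: an old numerator p has 2p < N, forcing exactness.
  extend : ∀ {K} → NearPairs K → RationalRoot ⊎ NearPairs (suc K)
  extend {K} ps with approximate D (suc (scale ps))
  ... | approximation p q 1≤q p≤ND close@(deficit , excess) with p * p ≟ D * (q * q)
  ...   | yes exact  = inj₁ (p , q , 1≤q , exact)
  ...   | no inexact = inj₂ (record { pair = pair' ; scale = scale ps + 2 * p ;
                                      small = small' ; distinct = distinct' })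
    where
    N = suc (scale ps)
    new : NearPair
    new = nearPair p q 1≤q (bounded-gap {N} deficit p≤ND) (bounded-gap {N} excess p≤ND) inexact
    pair' : Fin (suc K) → NearPair
    pair' zero    = new
    pair' (suc i) = pair ps i
    small' : ∀ i → 2 * num (pair' i) ≤ scale ps + 2 * p
    small' zero    = m≤n+m (2 * p) (scale ps)
    small' (suc i) = ≤-trans (small ps i) (m≤m+n (scale ps) (2 * p))
    fresh : ∀ i → num (pair ps i) ≢ p
    fresh i same = inexact (close⇒exact {N} {p} {q} close (s≤s (subst (λ a → 2 * a ≤ scale ps) same (small ps i))))
    distinct' : ∀ i j → num (pair' i) ≡ num (pair' j) → i ≡ j
    distinct' zero    zero    _    = refl
    distinct' zero    (suc j) same = contradiction (sym same) (fresh j)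
    distinct' (suc i) zero    same = contradiction same (fresh i)
    distinct' (suc i) (suc j) same = cong suc (distinct ps i j same)

  near-pairs : ∀ K → RationalRoot ⊎ NearPairs K
  near-pairs zero    = inj₂ (record { pair = λ () ; scale = 0 ; small = λ () ; distinct = λ () })
  near-pairs (suc K) with near-pairs K
  ... | inj₁ root = inj₁ root
  ... | inj₂ ps   = extend ps

  divides-factorial : ∀ {m n} → 1 ≤ m → m ≤ n → m ∣ n !
  divides-factorial {suc m} _ m≤n = ∣-trans (m∣m*n (m !)) (m≤n⇒m!∣n! m≤n)

  -- Every possible norm 0 < |p² − Dq²| ≤ 2D of a near pair divides M = (2D)!.
  M : ℕ
  M = (2 * D) !

  instance
    M≢0 : NonZero M
    M≢0 = (2 * D) !≢0

  normOf : NearPair → ℤ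
  normOf x = (num x * num x) ⊖ (D * (den x * den x))

  normOf-as-norm : ∀ x → norm (+ D) (+ num x) (+ den x) ≡ normOf x
  normOf-as-norm x = trans (cong₂ (λ a b → a ℤ.- b) (sym (ℤ.pos-* (num x) (num x)))
                             (trans (cong (+ D ℤ.*_) (sym (ℤ.pos-* (den x) (den x))))
                                    (sym (ℤ.pos-* D (den x * den x)))))
                           (ℤ.m-n≡m⊖n (num x * num x) (D * (den x * den x)))

  normOf≢0 : ∀ x → normOf x ≢ 0ℤ
  normOf≢0 x norm≡0 = inexact x (ℤ.+-injective (ℤ.i-j≡0⇒i≡j _ _
                        (trans (ℤ.m-n≡m⊖n (num x * num x) (D * (den x * den x))) norm≡0)))

  normOf∣M : ∀ x → Σ[ h ∈ ℤ ] + M ≡ normOf x ℤ.* h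
  normOf∣M x with ∣ᵤ⇒∣ {normOf x} {+ M} (divides-factorial 1≤∣k∣ ∣k∣≤2D)
    where
    ∣k∣≤2D : ∣ normOf x ∣ ≤ 2 * D
    ∣k∣≤2D = ∣⊖∣-bounded {num x * num x} {D * (den x * den x)} (excess≤ x) (deficit≤ x)
    1≤∣k∣ : 1 ≤ ∣ normOf x ∣
    1≤∣k∣ = n≢0⇒n>0 (λ ∣k∣≡0 → normOf≢0 x (ℤ.∣i∣≡0⇒i≡0 ∣k∣≡0))
  ... | divides h M≡hk = h , trans M≡hk (ℤ.*-comm h (normOf x))

  Gap : Set
  Gap = Fin (suc (2 * D))

  excessClass deficitClass : NearPair → Gap
  excessClass  x = fromℕ< (s≤s (excess≤ x))
  deficitClass x = fromℕ< (s≤s (deficit≤ x))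

  gapClass : NearPair → Fin (suc (2 * D) * suc (2 * D))
  gapClass x = combine (excessClass x) (deficitClass x)

  residueClass : NearPair → Fin (M * M)
  residueClass x = combine (num x mod M) (den x mod M)

  Classes : ℕ
  Classes = (suc (2 * D) * suc (2 * D)) * (M * M)

  class : NearPair → Fin Classes
  class x = combine (gapClass x) (residueClass x)

  same-class⇒same-norm : ∀ x y → class x ≡ class y → normOf x ≡ normOf y
  same-class⇒same-norm x y same
    with gaps , _ ← combine-injective (gapClass x) (residueClass x) (gapClass y) (residueClass y) same
    with excess≡ , deficit≡ ← combine-injective (excessClass x) (deficitClass x)
                                                (excessClass y) (deficitClass y) gaps = begin
      normOf x                                                     ≡⟨ ⊖-truncated (num x * num x) _ ⟩
      (num x * num x ∸ D * (den x * den x)) ⊖ (D * (den x * den x) ∸ num x * num x)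
        ≡⟨ cong₂ _⊖_ (fromℕ<-injective _ _ _ _ excess≡) (fromℕ<-injective _ _ _ _ deficit≡) ⟩
      (num y * num y ∸ D * (den y * den y)) ⊖ (D * (den y * den y) ∸ num y * num y)
                                                                   ≡⟨ ⊖-truncated (num y * num y) _ ⟨
      normOf y                                                     ∎
    where open ≡-Reasoning

  same-class⇒same-residues : ∀ x y → class x ≡ class y →
                             num x % M ≡ num y % M × den x % M ≡ den y % M
  same-class⇒same-residues x y same
    with _ , residues ← combine-injective (gapClass x) (residueClass x) (gapClass y) (residueClass y) same
    with num≡ , den≡ ← combine-injective (num x mod M) (den x mod M) (num y mod M) (den y mod M) residues =
      fromℕ<-injective _ _ _ _ num≡ , fromℕ<-injective _ _ _ _ den≡

  proportional⇒same-num : ∀ x y → normOf x ≡ normOf y →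
                          + num x ℤ.* + den y ≡ + num y ℤ.* + den x → num x ≡ num y
  proportional⇒same-num x y same-norm cross =
    *-cancelʳ-≡ (num x) (num y) (den x) {{>-nonZero (1≤den x)}}
      (ℤ.+-injective (trans (ℤ.pos-* (num x) (den x))
        (trans (cong (λ d → + num x ℤ.* + d) (sym den-eq))
          (trans cross (sym (ℤ.pos-* (num y) (den x)))))))
    where
    den-sq : den y * den y ≡ den x * den x
    den-sq = ℤ.+-injective (trans (ℤ.pos-* (den y) (den y))
               (trans (proportional⇒equal-squares (+ D) (normOf y) (+ num x) (+ den x) (+ num y) (+ den y)
                         (normOf≢0 y) (trans (normOf-as-norm x) same-norm) (normOf-as-norm y) cross)
                      (sym (ℤ.pos-* (den x) (den x)))))
    den-eq : den y ≡ den x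
    den-eq = ≤-antisym (square-cancel-≤ (≤-reflexive den-sq)) (square-cancel-≤ (≤-reflexive (sym den-sq)))

  -- Two near pairs in the same class with different numerators compose to a
  -- nontrivial solution: they share the norm k, and are congruent modulo M = kh.
  twins⇒pell : ∀ x y → class x ≡ class y → num x ≢ num y → PellSolution
  twins⇒pell x y same num≢ = X , Y , Y≢0 , solution
    where
    k h u v P Q P' Q' : ℤ
    k = normOf y
    h = proj₁ (normOf∣M y)
    u = + (num x / M) ℤ.- + (num y / M)
    v = + (den x / M) ℤ.- + (den y / M)
    P = + num x
    Q = + den x
    P' = + num y
    Q' = + den y

    congruent : ∀ m n → m % M ≡ n % M → + m ≡ + n ℤ.+ k ℤ.* h ℤ.* (+ (m / M) ℤ.- + (n / M))
    congruent m n same-residue = trans (residue-split M m n same-residue)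
                                   (cong (λ w → + n ℤ.+ w ℤ.* (+ (m / M) ℤ.- + (n / M))) (proj₂ (normOf∣M y)))

    P≡ : P ≡ P' ℤ.+ k ℤ.* h ℤ.* u
    P≡ = congruent (num x) (num y) (proj₁ (same-class⇒same-residues x y same))
    Q≡ : Q ≡ Q' ℤ.+ k ℤ.* h ℤ.* v
    Q≡ = congruent (den x) (den y) (proj₂ (same-class⇒same-residues x y same))

    norm-PQ : norm (+ D) P Q ≡ k
    norm-PQ = trans (normOf-as-norm x) (same-class⇒same-norm x y same)

    X Y : ℤ
    X = composedX (+ D) h u v P' Q'
    Y = composedY h u v P' Q'

    solution : norm (+ D) X Y ≡ 1ℤ
    solution = compose (+ D) k h u v P Q P' Q' (normOf≢0 y) (normOf-as-norm y) norm-PQ P≡ Q≡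

    -- Y = 0 would make the pairs proportional, hence equal.
    Y≢0 : Y ≢ 0ℤ
    Y≢0 Y≡0 = num≢ (proportional⇒same-num x y (same-class⇒same-norm x y same)
                     (subst₂ (λ a b → a ℤ.* Q' ≡ P' ℤ.* b) (sym P≡) (sym Q≡)
                       (composedY≡0⇒proportional k h u v P' Q' Y≡0)))

  -- Pell's equation: unless √D is rational, X² − DY² = 1 has a solution with Y ≠ 0.
  -- Among Classes + 1 near pairs with distinct numerators two share a class.
  pell : RationalRoot ⊎ PellSolution
  pell with near-pairs (suc Classes)
  ... | inj₁ root = inj₁ root
  ... | inj₂ ps with pigeonhole (n<1+n Classes) (λ i → class (pair ps i))
  ...   | i , j , i<j , same =
          inj₂ (twins⇒pell (pair ps i) (pair ps j) same (λ num≡ → <⇒≢ᶠ i<j (distinct ps i j num≡)))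

module Reduction where
  open import Data.Nat as ℕ using (ℕ; zero; suc)
  import Data.Nat.Properties as ℕ
  open import Data.Nat.Tactic.RingSolver as ℕ-Solver using ()
  open import Data.Integer hiding (suc)
  open import Data.Integer.Properties
  open import Data.Integer.Tactic.RingSolver using (solve-∀)
  open import Data.Product using (Σ-syntax; ∃-syntax; _×_; _,_)
  open import Data.Sum using (inj₁; inj₂)
  open import Relation.Binary.PropositionalEquality
  open import Relation.Nullary using (yes; no)
  open Composition using (norm)

  Solvable : ℤ → ℤ → Set
  Solvable a b = ∃[ x ] ∃[ y ] ∃[ z ] ((x * x - a * (y * y) - b * (z * z) ≡ 1ℤ) × (x * z ≢ 0ℤ))

  private
    twice≢1 : ∀ k → 2 ℕ.* k ≢ 1
    twice≢1 zero    ()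
    twice≢1 (suc k) eq = ℕ.m+1+n≢0 k (ℕ.suc-injective eq)

    odd≢0 : ∀ w → 1ℤ + + 2 * w ≢ 0ℤ
    odd≢0 w odd≡0 = twice≢1 ∣ w ∣ (trans (sym (abs-* (+ 2) w)) (cong ∣_∣ twice≡-1))
      where
      shift : ∀ w → + 2 * w ≡ (1ℤ + + 2 * w) - 1ℤ
      shift = solve-∀
      twice≡-1 : + 2 * w ≡ - 1ℤ
      twice≡-1 = trans (shift w) (cong (_- 1ℤ) odd≡0)

    -- −DY² ≤ 0 for D ≥ 0, so it is never 1.
    square-natural : ∀ Y → Y * Y ≡ + (∣ Y ∣ ℕ.* ∣ Y ∣)
    square-natural (+ n)    = sym (pos-* n n)
    square-natural -[1+ n ] = refl

    -neg≢1 : ∀ n → - (+ n) ≢ 1ℤ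
    -neg≢1 zero    ()
    -neg≢1 (suc n) ()

  from-conic : ∀ a b m n s → a ≢ 0ℤ → a * (m * m) + b * (n * n) ≡ s * s → b * s * n + m ≢ 0ℤ →
               Solvable a b
  from-conic a b m n s a≢0 on-conic z≢0 = x , y , z , equation , xz≢0
    where
    x y z : ℤ
    x = 1ℤ + + 2 * a * b * (s * s)
    y = + 2 * a * b * s * m - + 2 * b * n
    z = + 2 * a * (b * s * n + m)
    identity : ∀ a b s m n →
      (1ℤ + + 2 * a * b * (s * s)) * (1ℤ + + 2 * a * b * (s * s))
      - a * ((+ 2 * a * b * s * m - + 2 * b * n) * (+ 2 * a * b * s * m - + 2 * b * n))
      - b * ((+ 2 * a * (b * s * n + m)) * (+ 2 * a * (b * s * n + m)))
      ≡ 1ℤ - + 4 * a * b * (a * b * (s * s) + 1ℤ) * (a * (m * m) + b * (n * n) - s * s)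
    identity = solve-∀
    equation : x * x - a * (y * y) - b * (z * z) ≡ 1ℤ
    equation = begin
      x * x - a * (y * y) - b * (z * z)                          ≡⟨ identity a b s m n ⟩
      1ℤ - c * (a * (m * m) + b * (n * n) - s * s)              ≡⟨ cong (λ t → 1ℤ - c * (t - s * s)) on-conic ⟩
      1ℤ - c * (s * s - s * s)                                  ≡⟨ cong (λ t → 1ℤ - c * t) (+-inverseʳ (s * s)) ⟩
      1ℤ - c * 0ℤ                                               ≡⟨ cong (λ t → 1ℤ - t) (*-zeroʳ c) ⟩
      1ℤ                                                        ∎
      where
      open ≡-Reasoning
      c = + 4 * a * b * (a * b * (s * s) + 1ℤ)
    xz≢0 : x * z ≢ 0ℤ
    xz≢0 xz≡0 with i*j≡0⇒i≡0∨j≡0 x xz≡0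
    ... | inj₁ x≡0 = odd≢0 (a * b * (s * s)) (trans (cong (λ t → 1ℤ + t) (regroup a b s)) x≡0)
      where
      regroup : ∀ a b s → + 2 * (a * b * (s * s)) ≡ + 2 * a * b * (s * s)
      regroup = solve-∀
    ... | inj₂ z≡0 with i*j≡0⇒i≡0∨j≡0 (+ 2 * a) z≡0
    ...   | inj₂ w≡0 = z≢0 w≡0
    ...   | inj₁ 2a≡0 with i*j≡0⇒i≡0∨j≡0 (+ 2) 2a≡0
    ...     | inj₁ ()
    ...     | inj₂ a≡0 = a≢0 a≡0

  from-pell : ∀ a b m d X Y → a * (m * m) + b ≡ + suc d → Y ≢ 0ℤ →
              norm (+ suc d) X Y ≡ 1ℤ → Solvable a b
  from-pell a b m d X Y D≡ Y≢0 pell = X , m * Y , Y , equation , XY≢0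
    where
    regroup : ∀ a b m X Y → X * X - a * ((m * Y) * (m * Y)) - b * (Y * Y) ≡ X * X - (a * (m * m) + b) * (Y * Y)
    regroup = solve-∀
    equation : X * X - a * ((m * Y) * (m * Y)) - b * (Y * Y) ≡ 1ℤ
    equation = trans (regroup a b m X Y) (trans (cong (λ D → X * X - D * (Y * Y)) D≡) pell)
    -- X = 0 would give −DY² = 1, impossible for D > 0
    XY≢0 : X * Y ≢ 0ℤ
    XY≢0 XY≡0 with i*j≡0⇒i≡0∨j≡0 X XY≡0
    ... | inj₂ Y≡0 = Y≢0 Y≡0
    ... | inj₁ refl = -neg≢1 (suc d ℕ.* (∣ Y ∣ ℕ.* ∣ Y ∣)) (begin
      - + (suc d ℕ.* (∣ Y ∣ ℕ.* ∣ Y ∣))   ≡⟨ cong -_ (pos-* (suc d) _) ⟩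
      - (+ suc d * + (∣ Y ∣ ℕ.* ∣ Y ∣))   ≡⟨ cong (λ t → - (+ suc d * t)) (square-natural Y) ⟨
      - (+ suc d * (Y * Y))              ≡⟨ +-identityˡ _ ⟨
      0ℤ * 0ℤ - + suc d * (Y * Y)        ≡⟨ pell ⟩
      1ℤ                                 ∎)
      where open ≡-Reasoning

  private
    -- Replacing s by −s keeps s² and cannot make both bs + m and −bs + m vanish.
    sign-choice : ∀ b p m → m ≢ 0ℤ → Σ[ s ∈ ℤ ] (s * s ≡ p * p × b * s + m ≢ 0ℤ)
    sign-choice b p m m≢0 with b * p + m ≟ 0ℤ
    ... | no  bp+m≢0 = p , refl , bp+m≢0
    ... | yes bp+m≡0 = - p , neg-square p , both-vanish
      where
      neg-square : ∀ p → - p * - p ≡ p * p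
      neg-square = solve-∀
      sum : ∀ b p m → + 2 * m ≡ (b * p + m) + (b * - p + m)
      sum = solve-∀
      both-vanish : b * - p + m ≢ 0ℤ
      both-vanish b-p+m≡0 with i*j≡0⇒i≡0∨j≡0 (+ 2) (trans (sum b p m) (cong₂ _+_ bp+m≡0 b-p+m≡0))
      ... | inj₁ ()
      ... | inj₂ m≡0 = m≢0 m≡0

  from-rational-root : ∀ a b m d p q → a ≢ 0ℤ → m ≢ 0ℤ → a * (m * m) + b ≡ + suc d →
                       1 ℕ.≤ q → p ℕ.* p ≡ suc d ℕ.* (q ℕ.* q) → Solvable a b
  from-rational-root a b m d p q a≢0 m≢0 D≡ 1≤q exact
    with s , s²≡p² , bs+m≢0 ← sign-choice b (+ p) m m≢0 =
    from-conic a b (m * Q) Q s a≢0 on-conic z≢0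
    where
    Q : ℤ
    Q = + q
    regroup : ∀ a b m Q → a * ((m * Q) * (m * Q)) + b * (Q * Q) ≡ (a * (m * m) + b) * (Q * Q)
    regroup = solve-∀
    on-conic : a * ((m * Q) * (m * Q)) + b * (Q * Q) ≡ s * s
    on-conic = begin
      a * ((m * Q) * (m * Q)) + b * (Q * Q) ≡⟨ regroup a b m Q ⟩
      (a * (m * m) + b) * (Q * Q)           ≡⟨ cong (_* (Q * Q)) D≡ ⟩
      + suc d * (Q * Q)                     ≡⟨ cong (+ suc d *_) (pos-* q q) ⟨
      + suc d * + (q ℕ.* q)                 ≡⟨ pos-* (suc d) (q ℕ.* q) ⟨
      + (suc d ℕ.* (q ℕ.* q))               ≡⟨ cong +_ exact ⟨
      + (p ℕ.* p)                           ≡⟨ pos-* p p ⟩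
      + p * + p                             ≡⟨ s²≡p² ⟨
      s * s                                 ∎
      where open ≡-Reasoning
    factor : ∀ b s m Q → b * s * Q + m * Q ≡ (b * s + m) * Q
    factor = solve-∀
    z≢0 : b * s * Q + m * Q ≢ 0ℤ
    z≢0 z≡0 with i*j≡0⇒i≡0∨j≡0 (b * s + m) (trans (sym (factor b s m Q)) z≡0)
    ... | inj₁ bs+m≡0 = bs+m≢0 bs+m≡0
    ... | inj₂ Q≡0    = ℕ.<⇒≢ 1≤q (sym (+-injective Q≡0))

  positive-value : ∀ a' b → Σ[ m ∈ ℤ ] Σ[ d ∈ ℕ ] (m ≢ 0ℤ × +[1+ a' ] * (m * m) + b ≡ + suc d)
  positive-value a' (+ n)    = 1ℤ , a' ℕ.+ n , (λ ()) , cong (_+ + n) (*-identityʳ +[1+ a' ])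
  positive-value a' -[1+ n ] = + m , d , (λ ()) , value
    where
    m d : ℕ
    m = 2 ℕ.+ n
    d = a' ℕ.* (m ℕ.* m) ℕ.+ (n ℕ.* n ℕ.+ 3 ℕ.* n ℕ.+ 2)
    value-ℕ : ∀ a' n → suc (a' ℕ.* ((2 ℕ.+ n) ℕ.* (2 ℕ.+ n)) ℕ.+ (n ℕ.* n ℕ.+ 3 ℕ.* n ℕ.+ 2)) ℕ.+ suc n
              ≡ suc a' ℕ.* ((2 ℕ.+ n) ℕ.* (2 ℕ.+ n))
    value-ℕ = ℕ-Solver.solve-∀
    cancel : ∀ x y → x + y - y ≡ x
    cancel = solve-∀
    value : +[1+ a' ] * (+ m * + m) - + suc n ≡ + suc d
    value = begin
      + suc a' * (+ m * + m) - + suc n      ≡⟨ cong (λ t → + suc a' * t - + suc n) (pos-* m m) ⟨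
      + suc a' * + (m ℕ.* m) - + suc n      ≡⟨ cong (_- + suc n) (pos-* (suc a') (m ℕ.* m)) ⟨
      + (suc a' ℕ.* (m ℕ.* m)) - + suc n    ≡⟨ cong (λ t → + t - + suc n) (value-ℕ a' n) ⟨
      + (suc d ℕ.+ suc n) - + suc n         ≡⟨ cong (_- + suc n) (pos-+ (suc d) (suc n)) ⟩
      + suc d + + suc n - + suc n           ≡⟨ cancel (+ suc d) (+ suc n) ⟩
      + suc d                               ∎
      where open ≡-Reasoning

open import Defs
open import Data.Integer using (ℤ; _+_; _-_; _*_; _>_; +_; 0ℤ; 1ℤ; +<+; -[1+_]; +[1+_])
open import Data.Product using (∃-syntax; _×_; _,_)
open import Data.Sum using (inj₁; inj₂)
open import Relation.Binary.PropositionalEquality using (_≡_; _≢_)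

lemma8p3 : (a b : ℤ) → a > 0ℤ →
    ∃[ x ] ∃[ y ] ∃[ z ] ((x * x - a * (y * y) - b * (z * z) ≡ 1ℤ) × (x * z ≢ 0ℤ))
lemma8p3 (+ 0)      b (+<+ ())
lemma8p3 -[1+ _ ]   b ()
lemma8p3 +[1+ a' ] b _
  with m , d , m≢0 , D≡ ← Reduction.positive-value a' b
  with PellEquation.pell (suc d)
... | inj₁ (p , q , 1≤q , exact) = Reduction.from-rational-root +[1+ a' ] b m d p q (λ ()) m≢0 D≡ 1≤q exact
... | inj₂ (X , Y , Y≢0 , pell)  = Reduction.from-pell +[1+ a' ] b m d X Y D≡ Y≢0 pell
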